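{- Let $k\geq 4$ and let $\xi$, $\mathbf{u}$, $\pi$ be as in the context. Let $\ell\in\mathbb{N}$ satisfy $2\leq\ell\leq k-2$ or $k+2\leq\ell\leq 2k-2$, and let $w=\xi^\ell(0)$. Assume that (1) $x,y\in\mathrm{Rext}(w)$ are letters with $x\neq y$ and $\pi(x)=\pi(y)$, and (2) $u,v\in\mathcal{A}^*$ are such that $uwx$ and $vwy$ are factors of $\mathbf{u}$ and $\pi(u)=\pi(v)$ is a prefix of $1^{k-1}$ or of $0^{k-1}$. Then $|u|=|v|\leq k-3$.
   Context: Fix an integer $k\geq 4$. Let $\mathcal{A}=\{0,1,\ldots,k-1,0',1',\ldots,(k-1)'\}$. Let $\xi:\mathcal{A}^*\to\mathcal{A}^*$ be the morphism given by $\xi(0)=01$, $\xi(j)=j+1$ for $1\leq j\leq k-2$, $\xi(k-1)=0'$, and $\xi(0')=0'1'$, $\xi(j')=(j+1)'$ for $1\leq j\leq k-2$, $\xi((k-1)')=0$. Let $\mathbf{u}=\xi^\omega(0)$ be the infinite fixed point of $\xi$ starting with $0$. Let $\pi:\mathcal{A}^*\to\{0,1\}^*$ be the letter-to-letter morphism with $\pi(0)=0$, $\pi(j')=0$ for $1\leq j\leq k-1$, $\pi(0')=1$, $\pi(j)=1$ for $1\leq j\leq k-1$. $\mathrm{Rext}(w)$ is the set of letters $a$ such that $wa$ is a factor of $\mathbf{u}$. -}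

module Defs where

open import Data.Nat using (ℕ; zero; suc; _+_; _∸_; _<?_; NonZero)
open import Data.Fin using (Fin; zero; suc; toℕ; fromℕ<)
open import Data.Bool using (Bool; true; false; not)
open import Data.Product using (_×_; _,_; ∃)
open import Data.Maybe using (Maybe; just; nothing)
open import Data.List using (List; []; _∷_; _++_; map; concatMap; upTo; length; replicate)
open import Relation.Nullary using (yes; no)
open import Relation.Binary.PropositionalEquality using (_≡_)

-- Alphabet 𝒜 for parameter k: a letter is (primed? , index j) with j < k.
-- (false , j) is the letter j ; (true , j) is the letter j'.
Letter : ℕ → Set
Letter k = Bool × Fin k

next : ∀ {k} → Fin k → Maybe (Fin k)
next {k} j with suc (toℕ j) <? k
... | yes p = just (fromℕ< p)
... | no _ = nothing

zeroOf : ∀ {k} → Fin k → Fin k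
zeroOf {suc _} _ = zero

step : ∀ {k} → Bool → Fin k → Letter k
step b j with next j
... | just j' = (b , j')
... | nothing = (not b , zeroOf j)

ξ : ∀ {k} → Letter k → List (Letter k)
ξ (b , zero) = (b , zero) ∷ step b zero ∷ []
ξ (b , suc j) = step b (suc j) ∷ []

ξ* : ∀ {k} → List (Letter k) → List (Letter k)
ξ* = concatMap ξ

iter : ∀ {A : Set} → ℕ → (A → A) → A → A
iter zero f a = a
iter (suc n) f a = f (iter n f a)

letter0 : (k : ℕ) → .{{NonZero k}} → Letter k
letter0 (suc k) = (false , zero)

ξpow0 : (k : ℕ) → .{{NonZero k}} → ℕ → List (Letter k)
ξpow0 k n = iter n ξ* (letter0 k ∷ [])

nthOr : ∀ {A : Set} → A → List A → ℕ → A
nthOr d [] n = d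
nthOr d (x ∷ xs) zero = x
nthOr d (x ∷ xs) (suc n) = nthOr d xs n

-- the fixed point 𝐮 = ξ^ω(0): its n-th letter (0-indexed) is the n-th letter of
-- ξ^(n+1)(0), which has length > n and is a prefix of 𝐮 (default never used).
𝐮 : (k : ℕ) → .{{NonZero k}} → ℕ → Letter k
𝐮 k n = nthOr (letter0 k) (ξpow0 k (suc n)) n

IsFactor : (k : ℕ) → .{{NonZero k}} → List (Letter k) → Set
IsFactor k w = ∃ λ i → w ≡ map (λ j → 𝐮 k (i + j)) (upTo (length w))

Rext : (k : ℕ) → .{{NonZero k}} → List (Letter k) → Letter k → Set
Rext k w a = IsFactor k (w ++ a ∷ [])

-- π on letters (true = 1, false = 0): π(0)=0, π(j)=1 (j≥1), π(0')=1, π(j')=0 (j≥1)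
πL : ∀ {k} → Letter k → Bool
πL (b , zero) = b
πL (b , suc _) = not b

π : ∀ {k} → List (Letter k) → List Bool
π = map πL

IsPrefix : ∀ {A : Set} → List A → List A → Set
IsPrefix {A} p q = ∃ λ (s : List A) → p ++ s ≡ q

{-# OPTIONS --safe #-}
module Submission where

-- Write j and j' as (false , j) and (true , j). Then 𝐮 is a concatenation of blocks
-- (c,0)(c,1)⋯(c,m), and ξ lengthens every block by one letter, except that a block of the
-- maximal length k keeps its length and is followed by the new singleton block (not c , 0).
-- Because 𝐮 = ξ(𝐮) and ξ is recognizable (the image of a word, followed by a letter of
-- index ≠ 1, determines the word), occurrences can be desubstituted. Iterating this shows
-- that a complete block (c,0)⋯(c,m) with 1 ≤ m ≤ k - 2, i.e. one followed by a letter of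
-- index 0, is preceded by (c , m - 1), and that ξ^(k-1+t)(0)·0 is preceded by (true , t - 2)
-- for t ≥ 2. In both ranges of ℓ, distinct right extensions x, y of w with π x = π y make one
-- of the occurrences of wx, wy of this kind, so that w is preceded there by some (c , d + 1)
-- with d + 1 ≤ k - 3. The d + 2 letters before w are then (c,0)⋯(c,d+1), whose π-image is
-- not constant; hence the left context, whose π-image is constant, has length at most d + 1.

open import Defs
open import Data.Nat using (ℕ; zero; suc; _+_; _*_; _∸_; _≤_; _<_; NonZero; z≤n; s≤s; z<s; _<?_; _≤?_)
open import Data.Nat.Properties
open import Data.Nat.Induction using (<-rec)
open import Data.Nat.Tactic.RingSolver using (solve-∀)
open import Data.Bool using (Bool; true; false; not)
open import Data.Bool.Properties using (not-involutive; not-injective; not-¬)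
open import Data.Fin using (toℕ) renaming (zero to fzero; suc to fsuc)
open import Data.Fin.Properties using (toℕ<n; toℕ-injective; toℕ-fromℕ<)
open import Data.List using (List; []; _∷_; _++_; map; concatMap; length; replicate; applyUpTo)
open import Data.List.Properties using (concatMap-++; length-map; length-++; map-++; ++-assoc; ++-identityʳ; map-upTo)
open import Data.List.Relation.Unary.All using (All; []; _∷_)
open import Data.List.Relation.Unary.All.Properties using (++⁺; ++⁻ˡ; map⁻; replicate⁺)
open import Data.Product using (_×_; _,_; ∃; proj₁; proj₂)
open import Data.Sum using (_⊎_; inj₁; inj₂)
import Data.Sum as Sum
open import Data.Empty using (⊥-elim)
open import Data.Unit using (⊤; tt)
open import Function using (id)
open import Relation.Nullary using (¬_; yes; no)
open import Relation.Binary.PropositionalEquality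

nthOr-prefix : ∀ {A : Set} (d : A) {xs ys i} → IsPrefix xs ys → i < length xs → nthOr d ys i ≡ nthOr d xs i
nthOr-prefix d {_ ∷ xs} {i = zero} (r , refl) _ = refl
nthOr-prefix d {_ ∷ xs} {i = suc i} (r , refl) (s≤s i<) = nthOr-prefix d {xs} (r , refl) i<

nthOr-applyUpTo : ∀ {A : Set} (d : A) f {n i} → i < n → nthOr d (applyUpTo f n) i ≡ f i
nthOr-applyUpTo d f {suc n} {zero} _ = refl
nthOr-applyUpTo d f {suc n} {suc i} (s≤s i<) = nthOr-applyUpTo d (λ j → f (suc j)) i<

IsPrefix-trans : ∀ {A : Set} {xs ys zs : List A} → IsPrefix xs ys → IsPrefix ys zs → IsPrefix xs zs
IsPrefix-trans {xs = xs} (r , refl) (r′ , refl) = r ++ r′ , sym (++-assoc xs r r′)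

IsPrefix-replicate : ∀ {A : Set} {xs : List A} {m x} → IsPrefix xs (replicate m x) → All (_≡ x) xs
IsPrefix-replicate {xs = xs} {m} (r , eq) = ++⁻ˡ xs (subst (All _) (sym eq) (replicate⁺ m refl))

module Structure (n : ℕ) where

  k : ℕ
  k = 4 + n

  W : ℕ → List (Letter k)
  W = ξpow0 k

  ξpow0-prefix : ∀ m → IsPrefix (W m) (W (suc m))
  ξpow0-prefix zero = _ , refl
  ξpow0-prefix (suc m) with ξpow0-prefix m
  ... | r , eq = ξ* r , trans (sym (concatMap-++ ξ (W m) r)) (cong ξ* eq)

  ξpow0-prefix-≤ : ∀ {m m′} → m ≤ m′ → IsPrefix (W m) (W m′)
  ξpow0-prefix-≤ {m′ = zero} z≤n = [] , ++-identityʳ _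
  ξpow0-prefix-≤ {m′ = suc m′} m≤ with m≤n⇒m<n∨m≡n m≤
  ... | inj₁ (s≤s m≤m′) = IsPrefix-trans (ξpow0-prefix-≤ m≤m′) (ξpow0-prefix m′)
  ... | inj₂ refl = [] , ++-identityʳ _

  ξpow0-head : ∀ m → ∃ λ r → W m ≡ letter0 k ∷ r
  ξpow0-head zero = [] , refl
  ξpow0-head (suc m) with ξpow0-head m
  ... | r , eq = _ , cong ξ* eq

  length-ξ* : ∀ (M : List (Letter k)) → length M ≤ length (ξ* M)
  length-ξ* [] = z≤n
  length-ξ* ((b , fzero) ∷ M) = m≤n⇒m≤1+n (s≤s (length-ξ* M))
  length-ξ* ((b , fsuc j) ∷ M) = s≤s (length-ξ* M)

  ξpow0-length : ∀ m → m < length (W m)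
  ξpow0-length zero = s≤s z≤n
  ξpow0-length (suc m) with ξpow0-head m
  ... | r , eq = subst (λ M → suc m < length (ξ* M)) (sym eq) (s≤s (≤-trans m<|W| (s≤s (length-ξ* r))))
    where
    m<|W| : m < length (letter0 k ∷ r)
    m<|W| = subst (λ M → m < length M) eq (ξpow0-length m)

  𝐮-ξpow0 : ∀ m {q} → q < length (W m) → 𝐮 k q ≡ nthOr (letter0 k) (W m) q
  𝐮-ξpow0 m {q} q< with ≤-total m (suc q)
  ... | inj₁ m≤ = nthOr-prefix _ (ξpow0-prefix-≤ m≤) q<
  ... | inj₂ ≤m = sym (nthOr-prefix _ (ξpow0-prefix-≤ ≤m) (<-trans (n<1+n q) (ξpow0-length (suc q))))

  -- Indices as natural numbers (Letter k uses Fin k); the bound is tracked by InAlphabet.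
  Letterℕ : Set
  Letterℕ = Bool × ℕ

  colour : Letterℕ → Bool
  colour = proj₁

  index : Letterℕ → ℕ
  index = proj₂

  InAlphabet : Letterℕ → Set
  InAlphabet a = index a < k

  ⌊_⌋ : Letter k → Letterℕ
  ⌊ b , j ⌋ = b , toℕ j

  ⌊⌋-injective : ∀ {a a′} → ⌊ a ⌋ ≡ ⌊ a′ ⌋ → a ≡ a′
  ⌊⌋-injective {b , j} {b′ , j′} eq = cong₂ _,_ (cong colour eq) (toℕ-injective (cong index eq))

  shift : Letterℕ → Letterℕ
  shift (b , j) with suc j <? k
  ... | yes _ = b , suc j
  ... | no _ = not b , 0

  shift-< : ∀ {b j} → suc j < k → shift (b , j) ≡ (b , suc j)
  shift-< {b} {j} j+1<k with suc j <? k
  ... | yes _ = refl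
  ... | no j+1≮k = ⊥-elim (j+1≮k j+1<k)

  shift-top : ∀ {b j} → suc j ≡ k → shift (b , j) ≡ (not b , 0)
  shift-top {b} {j} j+1≡k with suc j <? k
  ... | yes j+1<k = ⊥-elim (<-irrefl j+1≡k j+1<k)
  ... | no _ = refl

  shift-injective : ∀ {a a′} → InAlphabet a → InAlphabet a′ → shift a ≡ shift a′ → a ≡ a′
  shift-injective {b , j} {b′ , j′} j<k j′<k eq with suc j <? k | suc j′ <? k
  shift-injective {b , j} {b′ , j′} j<k j′<k refl | yes _ | yes _ = refl
  shift-injective {b , j} {b′ , j′} j<k j′<k eq | no j+1≮k | no j′+1≮k =
    cong₂ _,_ (not-injective (cong colour eq))
      (suc-injective (trans (≤-antisym j<k (≮⇒≥ j+1≮k)) (sym (≤-antisym j′<k (≮⇒≥ j′+1≮k)))))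
  shift-injective {b , j} {b′ , j′} j<k j′<k () | yes _ | no _
  shift-injective {b , j} {b′ , j′} j<k j′<k () | no _ | yes _

  ξℕ : Letterℕ → List Letterℕ
  ξℕ (b , zero) = (b , zero) ∷ shift (b , zero) ∷ []
  ξℕ (b , suc j) = shift (b , suc j) ∷ []

  ξℕ* : List Letterℕ → List Letterℕ
  ξℕ* = concatMap ξℕ

  first : Letterℕ → Letterℕ
  first (b , zero) = b , zero
  first (b , suc j) = shift (b , suc j)

  index-first≢1 : ∀ a → index (first a) ≢ 1
  index-first≢1 (b , zero) ()
  index-first≢1 (b , suc j) with suc (suc j) <? k
  ... | yes _ = λ ()
  ... | no _ = λ ()

  first-≡-start : ∀ {a c} → InAlphabet a → first a ≡ (c , 0) → a ≡ (c , 0) ⊎ a ≡ (not c , k ∸ 1)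
  first-≡-start {b , zero} _ refl = inj₁ refl
  first-≡-start {b , suc j} j+1<k eq with suc (suc j) <? k
  first-≡-start {b , suc j} j+1<k () | yes _
  first-≡-start {b , suc j} j+1<k refl | no j+2≮k =
    inj₂ (cong₂ _,_ (sym (not-involutive b)) (suc-injective (≤-antisym j+1<k (≮⇒≥ j+2≮k))))

  ⌊step⌋ : ∀ b j → ⌊ step b j ⌋ ≡ shift (b , toℕ j)
  ⌊step⌋ b j with suc (toℕ j) <? k
  ... | yes j+1<k = cong (b ,_) (toℕ-fromℕ< j+1<k)
  ... | no _ = refl

  ⌊ξ⌋ : ∀ a → map ⌊_⌋ (ξ a) ≡ ξℕ ⌊ a ⌋
  ⌊ξ⌋ (b , fzero) = refl
  ⌊ξ⌋ (b , fsuc j) = cong (_∷ []) (⌊step⌋ b (fsuc j))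

  ⌊ξ*⌋ : ∀ M → map ⌊_⌋ (ξ* M) ≡ ξℕ* (map ⌊_⌋ M)
  ⌊ξ*⌋ [] = refl
  ⌊ξ*⌋ (a ∷ M) = trans (map-++ ⌊_⌋ (ξ a) (ξ* M)) (cong₂ _++_ (⌊ξ⌋ a) (⌊ξ*⌋ M))

  𝐮ℕ : ℕ → Letterℕ
  𝐮ℕ m = ⌊ 𝐮 k m ⌋

  InAlphabet-𝐮ℕ : ∀ m → InAlphabet (𝐮ℕ m)
  InAlphabet-𝐮ℕ m = toℕ<n (proj₂ (𝐮 k m))

  Occurs : List Letterℕ → ℕ → Set
  Occurs [] i = ⊤
  Occurs (a ∷ M) i = 𝐮ℕ i ≡ a × Occurs M (suc i)

  occurs-++⁻ : ∀ M₁ {M₂ i} → Occurs (M₁ ++ M₂) i → Occurs M₁ i × Occurs M₂ (length M₁ + i)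
  occurs-++⁻ [] occ = tt , occ
  occurs-++⁻ (a ∷ M₁) {M₂} {i} (eq , occ) with occurs-++⁻ M₁ occ
  ... | occ₁ , occ₂ = (eq , occ₁) , subst (Occurs M₂) (+-suc (length M₁) i) occ₂

  occurs-++⁺ : ∀ M₁ {M₂ i} → Occurs M₁ i → Occurs M₂ (length M₁ + i) → Occurs (M₁ ++ M₂) i
  occurs-++⁺ [] _ occ₂ = occ₂
  occurs-++⁺ (a ∷ M₁) {M₂} {i} (eq , occ₁) occ₂ =
    eq , occurs-++⁺ M₁ occ₁ (subst (Occurs M₂) (sym (+-suc (length M₁) i)) occ₂)

  occurs-⌊⌋ : ∀ M i → (∀ j → j < length M → 𝐮 k (i + j) ≡ nthOr (letter0 k) M j) →
              Occurs (map ⌊_⌋ M) i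
  occurs-⌊⌋ [] i _ = tt
  occurs-⌊⌋ (a ∷ M) i agree =
    cong ⌊_⌋ (trans (cong (𝐮 k) (sym (+-identityʳ i))) (agree 0 (s≤s z≤n))) ,
    occurs-⌊⌋ M (suc i) (λ j j< → trans (cong (𝐮 k) (sym (+-suc i j))) (agree (suc j) (s≤s j<)))

  ξpow0-occurs : ∀ m → Occurs (map ⌊_⌋ (W m)) 0
  ξpow0-occurs m = occurs-⌊⌋ (W m) 0 (λ j → 𝐮-ξpow0 m)

  factor-occurs : ∀ {M} → IsFactor k M → ∃ λ i → Occurs (map ⌊_⌋ M) i
  factor-occurs {M} (i , eq) = i , occurs-⌊⌋ M i λ j j< → sym (begin
      nthOr (letter0 k) M j
    ≡⟨ cong (λ N → nthOr (letter0 k) N j) (trans eq (map-upTo _ (length M))) ⟩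
      nthOr (letter0 k) (applyUpTo (λ j → 𝐮 k (i + j)) (length M)) j
    ≡⟨ nthOr-applyUpTo _ _ j< ⟩
      𝐮 k (i + j) ∎)
    where open ≡-Reasoning

  imageStart : ℕ → ℕ
  imageStart zero = 0
  imageStart (suc p) = length (ξℕ (𝐮ℕ p)) + imageStart p

  occurs-images : ∀ M i → Occurs M i → Occurs (ξℕ* M) (imageStart i) →
                  ∀ j → j < length M → Occurs (ξℕ (𝐮ℕ (j + i))) (imageStart (j + i))
  occurs-images (a ∷ M) i (refl , occ) occ′ j j< with occurs-++⁻ (ξℕ (𝐮ℕ i)) occ′
  occurs-images (a ∷ M) i (refl , occ) occ′ zero _ | here , _ = here
  occurs-images (a ∷ M) i (refl , occ) occ′ (suc j) (s≤s j<) | _ , rest =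
    subst (λ x → Occurs (ξℕ (𝐮ℕ x)) (imageStart x)) (+-suc j i) (occurs-images M (suc i) occ rest j j<)

  -- ξ^(p+1)(0) and its image ξ^(p+2)(0) are both prefixes of 𝐮.
  image-occurs : ∀ p → Occurs (ξℕ (𝐮ℕ p)) (imageStart p)
  image-occurs p =
    subst (λ x → Occurs (ξℕ (𝐮ℕ x)) (imageStart x)) (+-identityʳ p)
      (occurs-images (map ⌊_⌋ (W (suc p))) 0 (ξpow0-occurs (suc p))
        (subst (λ N → Occurs N 0) (⌊ξ*⌋ (W (suc p))) (ξpow0-occurs (2 + p)))
        p (subst (p <_) (sym (length-map ⌊_⌋ (W (suc p)))) (<-trans (n<1+n p) (ξpow0-length (suc p)))))

  first-of-image : ∀ p → 𝐮ℕ (imageStart p) ≡ first (𝐮ℕ p)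
  first-of-image p = first-letter (𝐮ℕ p) (image-occurs p)
    where
    first-letter : ∀ a {i} → Occurs (ξℕ a) i → 𝐮ℕ i ≡ first a
    first-letter (b , zero) (eq , _) = eq
    first-letter (b , suc j) (eq , _) = eq

  first-of-image′ : ∀ p {a} → 𝐮ℕ p ≡ a → 𝐮ℕ (imageStart p) ≡ first a
  first-of-image′ p refl = first-of-image p

  last-of-image : ∀ p → ∃ λ q → imageStart (suc p) ≡ suc q × 𝐮ℕ q ≡ shift (𝐮ℕ p)
  last-of-image p = last-letter (𝐮ℕ p) (image-occurs p)
    where
    last-letter : ∀ a {i} → Occurs (ξℕ a) i → ∃ λ q → length (ξℕ a) + i ≡ suc q × 𝐮ℕ q ≡ shift a
    last-letter (b , zero) {i} (_ , eq , _) = suc i , refl , eq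
    last-letter (b , suc j) {i} (eq , _) = i , refl , eq

  second-of-image : ∀ p → index (𝐮ℕ p) ≡ 0 → 𝐮ℕ (suc (imageStart p)) ≡ (colour (𝐮ℕ p) , 1)
  second-of-image p i≡0 with last-of-image p
  ... | q , eq , last rewrite i≡0 = trans (cong 𝐮ℕ (suc-injective eq)) last

  imageStart-suc-single : ∀ p {j} → index (𝐮ℕ p) ≡ suc j → imageStart (suc p) ≡ suc (imageStart p)
  imageStart-suc-single p i≡ = cong (λ j → length (ξℕ (colour (𝐮ℕ p) , j)) + imageStart p) i≡

  index-boundary≢1 : ∀ p → index (𝐮ℕ (imageStart p)) ≢ 1
  index-boundary≢1 p = subst (λ a → index a ≢ 1) (sym (first-of-image p)) (index-first≢1 (𝐮ℕ p))

  0<length-ξℕ : ∀ a → 0 < length (ξℕ a)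
  0<length-ξℕ (b , zero) = s≤s z≤n
  0<length-ξℕ (b , suc j) = s≤s z≤n

  suc<imageStart-suc : ∀ p → suc p < imageStart (suc p)
  suc<imageStart-suc zero = s≤s (s≤s z≤n)
  suc<imageStart-suc (suc p) = +-mono-≤ (0<length-ξℕ (𝐮ℕ (suc p))) (suc<imageStart-suc p)

  image-position : ∀ m → (∃ λ p → m ≡ imageStart p) ⊎
                         (∃ λ p → m ≡ suc (imageStart p) × index (𝐮ℕ p) ≡ 0)
  image-position zero = inj₁ (0 , refl)
  image-position (suc m) with image-position m
  ... | inj₂ (p , refl , i≡0) =
    inj₁ (suc p , sym (cong (λ j → length (ξℕ (colour (𝐮ℕ p) , j)) + imageStart p) i≡0))
  ... | inj₁ (p , refl) with index (𝐮ℕ p) in i≡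
  ...   | zero = inj₂ (p , refl , i≡)
  ...   | suc j = inj₁ (suc p , sym (imageStart-suc-single p i≡))

  data _▷_ : Letterℕ → Letterℕ → Set where
    starts : ∀ {a b} → a ▷ (b , 0)
    continues : ∀ {b j} → (b , j) ▷ (b , suc j)

  ▷-shift : ∀ a → a ▷ shift a
  ▷-shift (b , j) with suc j <? k
  ... | yes _ = continues
  ... | no _ = starts

  shift-▷-first : ∀ {a a′} → a ▷ a′ → InAlphabet a′ → shift a ▷ first a′
  shift-▷-first starts _ = starts
  shift-▷-first (continues {b} {j}) j+1<k rewrite shift-< {b} j+1<k = ▷-shift (b , suc j)

  ▷-pred : ∀ {a a′ b j} → a ▷ a′ → a′ ≡ (b , suc j) → a ≡ (b , j)
  ▷-pred continues refl = refl

  -- Two consecutive letters lie either inside an image (b,0)(b,1), or at the boundary between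
  -- the images of 𝐮ℕ p and 𝐮ℕ (p + 1), where they are shift (𝐮ℕ p) and first (𝐮ℕ (p + 1)).
  adjacent : ∀ m → 𝐮ℕ m ▷ 𝐮ℕ (suc m)
  adjacent = <-rec (λ m → 𝐮ℕ m ▷ 𝐮ℕ (suc m)) adjacent-from-smaller
    where
    at-boundary : ∀ p {q} → imageStart (suc p) ≡ suc q → 𝐮ℕ p ▷ 𝐮ℕ (suc p) → 𝐮ℕ q ▷ 𝐮ℕ (suc q)
    at-boundary p {q} eq p▷ with last-of-image p
    ... | q′ , eq′ , last rewrite suc-injective (trans (sym eq) eq′) =
      subst₂ _▷_ (sym last) (trans (sym (first-of-image (suc p))) (cong 𝐮ℕ eq′))
        (shift-▷-first p▷ (InAlphabet-𝐮ℕ (suc p)))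
    adjacent-from-smaller : ∀ m → (∀ {m′} → m′ < m → 𝐮ℕ m′ ▷ 𝐮ℕ (suc m′)) →
                            𝐮ℕ m ▷ 𝐮ℕ (suc m)
    adjacent-from-smaller m rec with image-position (suc m)
    ... | inj₁ (suc p , eq) =
      at-boundary p (sym eq) (rec (≤-pred (subst (suc (suc p) ≤_) (sym eq) (suc<imageStart-suc p))))
    ... | inj₂ (p , refl , i≡0) =
      subst₂ _▷_ (sym (trans (first-of-image p) (cong (λ j → first (colour (𝐮ℕ p) , j)) i≡0)))
        (sym (second-of-image p i≡0)) continues

  PrecededBy : ℕ → Letterℕ → Set
  PrecededBy q a = ∃ λ q′ → q ≡ suc q′ × 𝐮ℕ q′ ≡ a

  predecessor : ∀ m {b j} → 𝐮ℕ m ≡ (b , suc j) → PrecededBy m (b , j)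
  predecessor zero ()
  predecessor (suc m) eq = m , refl , ▷-pred (adjacent m) eq

  block-start : ∀ d {m c} → 𝐮ℕ (d + m) ≡ (c , d) → 𝐮ℕ m ≡ (c , 0)
  block-start zero eq = eq
  block-start (suc d) {m} eq with predecessor (suc (d + m)) eq
  ... | _ , refl , eq′ = block-start d eq′

  preceded-image : ∀ {p a} → PrecededBy p a → PrecededBy (imageStart p) (shift a)
  preceded-image (q , refl , refl) = last-of-image q

  -- Recognizability

  index-0-preimage : ∀ {q c} → 𝐮ℕ q ≡ (c , 0) →
                     ∃ λ p → q ≡ imageStart p × (𝐮ℕ p ≡ (c , 0) ⊎ 𝐮ℕ p ≡ (not c , k ∸ 1))
  index-0-preimage {q} q≡ with image-position q
  ... | inj₂ (p , refl , i≡0) = ⊥-elim (1+n≢0 (trans (cong index (sym (second-of-image p i≡0))) (cong index q≡)))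
  ... | inj₁ (p , refl) = p , refl , first-≡-start (InAlphabet-𝐮ℕ p) (trans (sym (first-of-image p)) q≡)

  image-start : ∀ {q c} → 𝐮ℕ q ≡ (c , 0) → 𝐮ℕ (suc q) ≡ (c , 1) →
                ∃ λ p → q ≡ imageStart p × 𝐮ℕ p ≡ (c , 0)
  image-start {q} q≡ q+1≡ with index-0-preimage {q} q≡
  ... | p , refl , inj₁ e = p , refl , e
  ... | p , refl , inj₂ e = ⊥-elim (index-boundary≢1 (suc p)
                              (cong index (trans (cong 𝐮ℕ (imageStart-suc-single p (cong index e))) q+1≡)))

  -- ξℕ (b , 0) and ξℕ (not b , k - 1) both start with (b , 0); only after the former does a
  -- letter of index 1 follow.
  image-determines-letter : ∀ p a → InAlphabet a → Occurs (ξℕ a) (imageStart p) →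
                            index (𝐮ℕ (length (ξℕ a) + imageStart p)) ≢ 1 → 𝐮ℕ p ≡ a
  image-determines-letter p a a<k occ next≢1 with 𝐮ℕ p in e | a | occ
  ... | b′ , zero | b , zero | e₀ , _ = trans (sym (first-of-image′ p e)) e₀
  ... | b′ , zero | b , suc j | _ = ⊥-elim (next≢1 (cong index (second-of-image p (cong index e))))
  ... | b′ , suc j′ | b , zero | _ , e₁ , _ =
    ⊥-elim (index-boundary≢1 (suc p) (cong index (trans (cong 𝐮ℕ (imageStart-suc-single p (cong index e))) e₁)))
  ... | b′ , suc j′ | b , suc j | e₀ , _ =
    shift-injective (subst InAlphabet e (InAlphabet-𝐮ℕ p)) a<k (trans (sym (first-of-image′ p e)) e₀)

  index-image-start≢1 : ∀ M {z i} → index z ≢ 1 → Occurs (ξℕ* M ++ z ∷ []) i → index (𝐮ℕ i) ≢ 1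
  index-image-start≢1 [] z≢1 (eq , _) = subst (λ a → index a ≢ 1) (sym eq) z≢1
  index-image-start≢1 (a@(_ , zero) ∷ M) _ (eq , _) = subst (λ a → index a ≢ 1) (sym eq) (index-first≢1 a)
  index-image-start≢1 (a@(_ , suc _) ∷ M) _ (eq , _) = subst (λ a → index a ≢ 1) (sym eq) (index-first≢1 a)

  desubstitute : ∀ M {p z} → All InAlphabet M → index z ≢ 1 → Occurs (ξℕ* M ++ z ∷ []) (imageStart p) →
                 Occurs M p × imageStart (length M + p) ≡ length (ξℕ* M) + imageStart p
  desubstitute [] _ _ _ = tt , refl
  desubstitute (a ∷ M) {p} {z} (a<k ∷ M<k) z≢1 occ = (𝐮ℕp≡a , proj₁ rest) , position
    where
    split : Occurs (ξℕ a) (imageStart p) × Occurs (ξℕ* M ++ z ∷ []) (length (ξℕ a) + imageStart p)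
    split = occurs-++⁻ (ξℕ a) (subst (λ N → Occurs N (imageStart p)) (++-assoc (ξℕ a) (ξℕ* M) (z ∷ [])) occ)
    𝐮ℕp≡a : 𝐮ℕ p ≡ a
    𝐮ℕp≡a = image-determines-letter p a a<k (proj₁ split) (index-image-start≢1 M z≢1 (proj₂ split))
    imageStart-suc : imageStart (suc p) ≡ length (ξℕ a) + imageStart p
    imageStart-suc = cong (λ x → length (ξℕ x) + imageStart p) 𝐮ℕp≡a
    rest : Occurs M (suc p) × imageStart (length M + suc p) ≡ length (ξℕ* M) + imageStart (suc p)
    rest = desubstitute M M<k z≢1 (subst (Occurs (ξℕ* M ++ z ∷ [])) (sym imageStart-suc) (proj₂ split))
    position : imageStart (suc (length M + p)) ≡ length (ξℕ* (a ∷ M)) + imageStart p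
    position = begin
        imageStart (suc (length M + p))
      ≡⟨ cong imageStart (sym (+-suc (length M) p)) ⟩
        imageStart (length M + suc p)
      ≡⟨ proj₂ rest ⟩
        length (ξℕ* M) + imageStart (suc p)
      ≡⟨ cong (length (ξℕ* M) +_) imageStart-suc ⟩
        length (ξℕ* M) + (length (ξℕ a) + imageStart p)
      ≡⟨ sym (+-assoc (length (ξℕ* M)) _ _) ⟩
        length (ξℕ* M) + length (ξℕ a) + imageStart p
      ≡⟨ cong (_+ imageStart p) (trans (+-comm (length (ξℕ* M)) _) (sym (length-++ (ξℕ a)))) ⟩
        length (ξℕ* (a ∷ M)) + imageStart p ∎
      where open ≡-Reasoning

  preimage : ∀ P {c R q z} → P ≡ (c , 0) ∷ R → All InAlphabet P → index z ≡ 0 →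
             Occurs (ξℕ* P ++ z ∷ []) q →
             ∃ λ p → q ≡ imageStart p × ∃ λ a → Occurs (P ++ a ∷ []) p ×
               (a ≡ z ⊎ a ≡ (not (colour z) , k ∸ 1))
  preimage P {q = q} {z} refl valid z≡0 occ with image-start {q} (proj₁ occ) (proj₁ (proj₂ occ))
  ... | p , refl , _ with desubstitute P valid (λ z≡1 → 1+n≢0 (trans (sym z≡1) z≡0)) occ
  ...   | occP , position = p , refl , a , occurs-++⁺ P occP (refl , tt) , follower
    where
    a = 𝐮ℕ (length P + p)
    first≡z : first a ≡ (colour z , 0)
    first≡z = begin
        first a
      ≡⟨ sym (first-of-image (length P + p)) ⟩
        𝐮ℕ (imageStart (length P + p))
      ≡⟨ cong 𝐮ℕ position ⟩
        𝐮ℕ (length (ξℕ* P) + imageStart p)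
      ≡⟨ proj₁ (proj₂ (occurs-++⁻ (ξℕ* P) occ)) ⟩
        z
      ≡⟨ cong (colour z ,_) z≡0 ⟩
        (colour z , 0) ∎
      where open ≡-Reasoning
    follower : a ≡ z ⊎ a ≡ (not (colour z) , k ∸ 1)
    follower with first-≡-start (InAlphabet-𝐮ℕ (length P + p)) first≡z
    ... | inj₁ eq = inj₁ (trans eq (cong (colour z ,_) (sym z≡0)))
    ... | inj₂ eq = inj₂ eq

  occurs-snoc-▷ : ∀ X {a z q} → Occurs ((X ++ a ∷ []) ++ z ∷ []) q → a ▷ z
  occurs-snoc-▷ X {a} {z} {q} occ with occurs-++⁻ X (subst (λ N → Occurs N q) (++-assoc X (a ∷ []) (z ∷ [])) occ)
  ... | _ , e₀ , e₁ , _ = subst₂ _▷_ e₀ e₁ (adjacent (length X + q))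

  block : Bool → ℕ → List Letterℕ
  block c zero = (c , 0) ∷ []
  block c (suc m) = block c m ++ (c , suc m) ∷ []

  block-head : ∀ c m → ∃ λ R → block c m ≡ (c , 0) ∷ R
  block-head c zero = [] , refl
  block-head c (suc m) with block-head c m
  ... | R , eq = R ++ (c , suc m) ∷ [] , cong (_++ (c , suc m) ∷ []) eq

  block-snoc : ∀ c m → ∃ λ X → block c m ≡ X ++ (c , m) ∷ []
  block-snoc c zero = [] , refl
  block-snoc c (suc m) = block c m , refl

  block-inAlphabet : ∀ c m → m < k → All InAlphabet (block c m)
  block-inAlphabet c zero _ = s≤s z≤n ∷ []
  block-inAlphabet c (suc m) m+1<k = ++⁺ (block-inAlphabet c m (<-trans (n<1+n m) m+1<k)) (m+1<k ∷ [])

  ξℕ*-block : ∀ c m → suc m < k → ξℕ* (block c m) ≡ block c (suc m)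
  ξℕ*-block c zero _ = refl
  ξℕ*-block c (suc m) m+2<k = begin
      ξℕ* (block c m ++ (c , suc m) ∷ [])
    ≡⟨ concatMap-++ ξℕ (block c m) _ ⟩
      ξℕ* (block c m) ++ shift (c , suc m) ∷ []
    ≡⟨ cong₂ (λ X a → X ++ a ∷ []) (ξℕ*-block c m (<-trans (n<1+n _) m+2<k)) (shift-< m+2<k) ⟩
      block c (suc (suc m)) ∎
    where open ≡-Reasoning

  ξℕ*-block-top : ∀ c → ξℕ* (block c (k ∸ 1)) ≡ block c (k ∸ 1) ++ (not c , 0) ∷ []
  ξℕ*-block-top c = trans (concatMap-++ ξℕ (block c (k ∸ 2)) _)
    (cong₂ (λ X a → X ++ a ∷ []) (ξℕ*-block c (k ∸ 2) ≤-refl) (shift-top refl))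

  block-follower : ∀ {c m z q} → Occurs (block c m ++ z ∷ []) q → (c , m) ▷ z
  block-follower {c} {m} {z} {q} occ with block-snoc c m
  ... | X , eq = occurs-snoc-▷ X (subst (λ N → Occurs (N ++ z ∷ []) q) eq occ)

  before : Bool → ℕ → Letterℕ
  before c zero = not c , k ∸ 1
  before c (suc m) = c , m

  shift-before : ∀ {c} m → m < k → shift (before c m) ≡ before c (suc m)
  shift-before {c} zero _ = trans (shift-top refl) (cong (_, 0) (not-involutive c))
  shift-before (suc m) m+1<k = shift-< m+1<k

  -- The disjunction excludes the other preimage of block c (k - 1) followed by z, namely
  -- block c (k - 1) itself, whose image is followed by (not c , 0).
  complete-block-preimage : ∀ m {c q z} → suc m < k → index z ≡ 0 → suc (suc m) < k ⊎ colour z ≡ c →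
                            Occurs (block c (suc m) ++ z ∷ []) q →
                            ∃ λ p → q ≡ imageStart p × Occurs (block c m ++ z ∷ []) p
  complete-block-preimage m {c} {q} {z} m+1<k z≡0 short-or-same occ
    with preimage (block c m) (proj₂ (block-head c m)) (block-inAlphabet c m (<-trans (n<1+n m) m+1<k)) z≡0
           (subst (λ N → Occurs (N ++ z ∷ []) q) (sym (ξℕ*-block c m m+1<k)) occ)
  ... | p , refl , _ , occ′ , inj₁ refl = p , refl , occ′
  ... | p , refl , _ , occ′ , inj₂ refl with ▷-pred (block-follower {c} {m} occ′) refl | short-or-same
  ...   | last≡ | inj₁ m+2<k = ⊥-elim (<-irrefl (cong index last≡) (≤-pred (≤-pred m+2<k)))
  ...   | last≡ | inj₂ same = ⊥-elim (not-¬ refl (trans (cong colour last≡) (cong not same)))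

  before-complete-block : ∀ m {c q z} → suc m < k → index z ≡ 0 → Occurs (block c m ++ z ∷ []) q →
                          PrecededBy q (before c m)
  before-complete-block zero {q = q} _ z≡0 (e₀ , e₁ , _) with index-0-preimage {q} e₀
  ... | p , refl , inj₁ e =
    ⊥-elim (1+n≢0 (trans (cong index (sym (second-of-image p (cong index e)))) (trans (cong index e₁) z≡0)))
  ... | p , refl , inj₂ e = subst (PrecededBy (imageStart p)) (shift-< ≤-refl) (preceded-image (predecessor p e))
  before-complete-block (suc m) m+2<k z≡0 occ
    with complete-block-preimage m (<-trans (n<1+n _) m+2<k) z≡0 (inj₁ m+2<k) occ
  ... | p , refl , occ′ =
    subst (PrecededBy (imageStart p)) (shift-before m (<-trans (n<1+n _) (<-trans (n<1+n _) m+2<k)))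
      (preceded-image (before-complete-block m (<-trans (n<1+n _) m+2<k) z≡0 occ′))

  -- Ladders: ⌊ ξ^(k-1+t)(0) ⌋ = 0 1 ⋯ (k-1) · 0' · 0'1' · ⋯ · 0'1'⋯(t-1)'

  staircase : ℕ → List Letterℕ
  staircase zero = []
  staircase (suc t) = staircase t ++ block true t

  ladder : ℕ → List Letterℕ
  ladder t = block false (k ∸ 1) ++ staircase t

  lastOfLadder : ℕ → Letterℕ
  lastOfLadder zero = false , k ∸ 1
  lastOfLadder (suc t) = true , t

  ξℕ*-staircase : ∀ t → t < k → (true , 0) ∷ ξℕ* (staircase t) ≡ staircase (suc t)
  ξℕ*-staircase zero _ = refl
  ξℕ*-staircase (suc t) t+1<k =
    trans (cong ((true , 0) ∷_) (concatMap-++ ξℕ (staircase t) (block true t)))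
      (cong₂ _++_ (ξℕ*-staircase t (<-trans (n<1+n t) t+1<k)) (ξℕ*-block true t t+1<k))

  ξℕ*-ladder : ∀ t → t < k → ξℕ* (ladder t) ≡ ladder (suc t)
  ξℕ*-ladder t t<k = begin
      ξℕ* (block false (k ∸ 1) ++ staircase t)
    ≡⟨ concatMap-++ ξℕ (block false (k ∸ 1)) (staircase t) ⟩
      ξℕ* (block false (k ∸ 1)) ++ ξℕ* (staircase t)
    ≡⟨ cong (_++ ξℕ* (staircase t)) (ξℕ*-block-top false) ⟩
      (block false (k ∸ 1) ++ (true , 0) ∷ []) ++ ξℕ* (staircase t)
    ≡⟨ ++-assoc (block false (k ∸ 1)) _ _ ⟩
      block false (k ∸ 1) ++ (true , 0) ∷ ξℕ* (staircase t)
    ≡⟨ cong (block false (k ∸ 1) ++_) (ξℕ*-staircase t t<k) ⟩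
      ladder (suc t) ∎
    where open ≡-Reasoning

  ladder-head : ∀ t → ∃ λ R → ladder t ≡ (false , 0) ∷ R
  ladder-head t with block-head false (k ∸ 1)
  ... | R , eq = R ++ staircase t , cong (_++ staircase t) eq

  ladder-snoc : ∀ t → ∃ λ X → ladder t ≡ X ++ lastOfLadder t ∷ []
  ladder-snoc zero = block false (k ∸ 2) , ++-identityʳ _
  ladder-snoc (suc t) with block-snoc true t
  ... | Y , eq = block false (k ∸ 1) ++ (staircase t ++ Y) , (begin
      block false (k ∸ 1) ++ (staircase t ++ block true t)
    ≡⟨ cong (λ B → block false (k ∸ 1) ++ (staircase t ++ B)) eq ⟩
      block false (k ∸ 1) ++ (staircase t ++ (Y ++ (true , t) ∷ []))
    ≡⟨ cong (block false (k ∸ 1) ++_) (sym (++-assoc (staircase t) Y _)) ⟩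
      block false (k ∸ 1) ++ ((staircase t ++ Y) ++ (true , t) ∷ [])
    ≡⟨ sym (++-assoc (block false (k ∸ 1)) (staircase t ++ Y) _) ⟩
      (block false (k ∸ 1) ++ (staircase t ++ Y)) ++ (true , t) ∷ [] ∎)
    where open ≡-Reasoning

  staircase-inAlphabet : ∀ t → t ≤ k → All InAlphabet (staircase t)
  staircase-inAlphabet zero _ = []
  staircase-inAlphabet (suc t) t<k = ++⁺ (staircase-inAlphabet t (<⇒≤ t<k)) (block-inAlphabet true t t<k)

  ladder-inAlphabet : ∀ t → t ≤ k → All InAlphabet (ladder t)
  ladder-inAlphabet t t≤k = ++⁺ (block-inAlphabet false (k ∸ 1) ≤-refl) (staircase-inAlphabet t t≤k)

  ladder-follower : ∀ t {z q} → Occurs (ladder t ++ z ∷ []) q → lastOfLadder t ▷ z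
  ladder-follower t {z} {q} occ with ladder-snoc t
  ... | X , eq = occurs-snoc-▷ X (subst (λ N → Occurs (N ++ z ∷ []) q) eq occ)

  beforeLadder : ℕ → Letterℕ
  beforeLadder zero = false , k ∸ 2
  beforeLadder (suc t) = lastOfLadder t

  shift-beforeLadder : ∀ t → suc t < k → shift (beforeLadder t) ≡ beforeLadder (suc t)
  shift-beforeLadder zero _ = shift-< ≤-refl
  shift-beforeLadder (suc zero) _ = shift-top refl
  shift-beforeLadder (suc (suc t)) t+3<k = shift-< (<-trans (n<1+n _) (<-trans (n<1+n _) t+3<k))

  lastOfLadder-≢ : ∀ t → suc t < k → lastOfLadder t ≢ (true , k ∸ 2)
  lastOfLadder-≢ zero _ ()
  lastOfLadder-≢ (suc t) t+2<k eq = <-irrefl (cong index eq) (≤-pred (≤-pred t+2<k))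

  before-ladder : ∀ t {q} → t < k → Occurs (ladder t ++ (false , 0) ∷ []) q → PrecededBy q (beforeLadder t)
  before-ladder zero {q} _ occ
    with complete-block-preimage (k ∸ 2) ≤-refl refl (inj₂ refl)
           (subst (λ N → Occurs (N ++ (false , 0) ∷ []) q) (++-identityʳ _) occ)
  ... | p , refl , occ′ =
    subst (PrecededBy (imageStart p)) (shift-< (m≤n⇒m≤1+n ≤-refl))
      (preceded-image (before-complete-block (k ∸ 2) ≤-refl refl occ′))
  before-ladder (suc t) {q} t+1<k occ
    with preimage (ladder t) (proj₂ (ladder-head t)) (ladder-inAlphabet t (<⇒≤ (<-trans (n<1+n t) t+1<k))) refl
           (subst (λ N → Occurs (N ++ (false , 0) ∷ []) q) (sym (ξℕ*-ladder t (<-trans (n<1+n t) t+1<k))) occ)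
  ... | p , refl , _ , occ′ , inj₁ refl =
    subst (PrecededBy (imageStart p)) (shift-beforeLadder t t+1<k)
      (preceded-image (before-ladder t (<-trans (n<1+n t) t+1<k) occ′))
  ... | p , refl , _ , occ′ , inj₂ refl =
    ⊥-elim (lastOfLadder-≢ t t+1<k (▷-pred (ladder-follower t occ′) refl))

  ⌊ξpow0⌋-block : ∀ m → m < k → map ⌊_⌋ (W m) ≡ block false m
  ⌊ξpow0⌋-block zero _ = refl
  ⌊ξpow0⌋-block (suc m) m+1<k =
    trans (⌊ξ*⌋ (W m))
      (trans (cong ξℕ* (⌊ξpow0⌋-block m (<-trans (n<1+n m) m+1<k))) (ξℕ*-block false m m+1<k))

  ⌊ξpow0⌋-ladder : ∀ t → t < k → map ⌊_⌋ (W (t + (k ∸ 1))) ≡ ladder t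
  ⌊ξpow0⌋-ladder zero _ = trans (⌊ξpow0⌋-block (k ∸ 1) ≤-refl) (sym (++-identityʳ _))
  ⌊ξpow0⌋-ladder (suc t) t+1<k =
    trans (⌊ξ*⌋ (W (t + (k ∸ 1))))
      (trans (cong ξℕ* (⌊ξpow0⌋-ladder t (<-trans (n<1+n t) t+1<k))) (ξℕ*-ladder t (<-trans (n<1+n t) t+1<k)))

  factor-split : ∀ ℓ {P} → map ⌊_⌋ (W ℓ) ≡ P → ∀ u x → IsFactor k (u ++ W ℓ ++ x ∷ []) →
                 ∃ λ i → Occurs (map ⌊_⌋ u) i × Occurs (P ++ ⌊ x ⌋ ∷ []) (length u + i)
  factor-split ℓ refl u x fac with factor-occurs fac
  ... | i , occ with occurs-++⁻ (map ⌊_⌋ u) (subst (λ N → Occurs N i) (map-++ ⌊_⌋ u (W ℓ ++ x ∷ [])) occ)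
  ...   | occU , occWx =
    i , occU , subst₂ Occurs (map-++ ⌊_⌋ (W ℓ) (x ∷ [])) (cong (_+ i) (length-map ⌊_⌋ u)) occWx

  πℕ : Letterℕ → Bool
  πℕ (b , zero) = b
  πℕ (b , suc _) = not b

  πL≡πℕ : ∀ a → πL a ≡ πℕ ⌊ a ⌋
  πL≡πℕ (b , fzero) = refl
  πL≡πℕ (b , fsuc _) = refl

  π-at : ∀ u {b i} → All (λ a → πL a ≡ b) u → Occurs (map ⌊_⌋ u) i →
         ∀ j → j < length u → πℕ (𝐮ℕ (j + i)) ≡ b
  π-at (a ∷ u) (πa≡b ∷ _) (eq , _) zero _ = trans (cong πℕ eq) (trans (sym (πL≡πℕ a)) πa≡b)
  π-at (a ∷ u) {b} {i} (_ ∷ πu≡b) (_ , occ) (suc j) (s≤s j<) =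
    subst (λ x → πℕ (𝐮ℕ x) ≡ b) (+-suc j i) (π-at u πu≡b occ j j<)

  -- Otherwise u would end with (c,0)(c,1)⋯(c,d+1), whose π-values are c and not c.
  π-constant⇒length≤ : ∀ u {b i c d} → All (_≡ b) (π u) → Occurs (map ⌊_⌋ u) i →
                        PrecededBy (length u + i) (c , suc d) → length u ≤ suc d
  π-constant⇒length≤ u {b} {i} {c} {d} πu≡b occ (e , e+1≡ , 𝐮ℕe≡) with length u ≤? suc d
  ... | yes |u|≤ = |u|≤
  ... | no |u|≰ with m≤n⇒∃[o]m+o≡n (≰⇒> |u|≰)
  ...   | r , |u|≡ = ⊥-elim (not-¬ refl (trans c≡b (sym notc≡b)))
    where
    at : ∀ j → j < length u → πℕ (𝐮ℕ (j + i)) ≡ b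
    at = π-at u (map⁻ πu≡b) occ
    last : 𝐮ℕ (suc d + r + i) ≡ (c , suc d)
    last = subst (λ x → 𝐮ℕ x ≡ (c , suc d))
             (suc-injective (trans (sym e+1≡) (cong (_+ i) (sym |u|≡)))) 𝐮ℕe≡
    start : 𝐮ℕ (r + i) ≡ (c , 0)
    start = block-start (suc d) (subst (λ x → 𝐮ℕ x ≡ (c , suc d)) (+-assoc (suc d) r i) last)
    notc≡b : not c ≡ b
    notc≡b = trans (cong πℕ (sym last)) (at (suc d + r) (subst (suc d + r <_) |u|≡ ≤-refl))
    c≡b : c ≡ b
    c≡b = trans (cong πℕ (sym start)) (at r (subst (r <_) |u|≡ (m<n+m r z<s)))

  distinct-followers : ∀ {a x y} → a ▷ x → a ▷ y → x ≢ y → index x ≡ 0 ⊎ index y ≡ 0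
  distinct-followers starts _ _ = inj₁ refl
  distinct-followers continues starts _ = inj₂ refl
  distinct-followers continues continues x≢y = ⊥-elim (x≢y refl)

  distinct-followers-π : ∀ {j x y} → (true , j) ▷ x → (true , j) ▷ y → x ≢ y → πℕ x ≡ πℕ y →
                         x ≡ (false , 0) ⊎ y ≡ (false , 0)
  distinct-followers-π (starts {b = false}) _ _ _ = inj₁ refl
  distinct-followers-π _ (starts {b = false}) _ _ = inj₂ refl
  distinct-followers-π (starts {b = true}) (starts {b = true}) x≢y _ = ⊥-elim (x≢y refl)
  distinct-followers-π (starts {b = true}) continues _ ()
  distinct-followers-π continues (starts {b = true}) _ ()
  distinct-followers-π continues continues x≢y _ = ⊥-elim (x≢y refl)

  left-context-block : ∀ d {x y} → suc (suc d) ≤ k ∸ 2 → x ≢ y → ∀ u v {b} →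
                       All (_≡ b) (π u) → All (_≡ b) (π v) →
                       IsFactor k (u ++ W (2 + d) ++ x ∷ []) → IsFactor k (v ++ W (2 + d) ++ y ∷ []) →
                       length u ≤ suc d ⊎ length v ≤ suc d
  left-context-block d {x} {y} ℓ≤ x≢y u v πu πv fu fv
    with factor-split (2 + d) shape u x fu | factor-split (2 + d) shape v y fv
    where
    shape = ⌊ξpow0⌋-block (2 + d) (m≤n⇒m≤1+n (s≤s ℓ≤))
  ... | i , occU , occX | j , occV , occY
    with distinct-followers (block-follower occX) (block-follower occY) (λ eq → x≢y (⌊⌋-injective eq))
  ... | inj₁ x₀ = inj₁ (π-constant⇒length≤ u πu occU
                    (before-complete-block (2 + d) (s≤s (s≤s ℓ≤)) x₀ occX))
  ... | inj₂ y₀ = inj₂ (π-constant⇒length≤ v πv occV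
                    (before-complete-block (2 + d) (s≤s (s≤s ℓ≤)) y₀ occY))

  left-context-ladder : ∀ d {x y} → suc (suc (suc d)) ≤ k ∸ 1 → x ≢ y → πL x ≡ πL y → ∀ u v {b} →
                        All (_≡ b) (π u) → All (_≡ b) (π v) →
                        IsFactor k (u ++ W (3 + d + (k ∸ 1)) ++ x ∷ []) →
                        IsFactor k (v ++ W (3 + d + (k ∸ 1)) ++ y ∷ []) →
                        length u ≤ suc d ⊎ length v ≤ suc d
  left-context-ladder d {x} {y} t≤ x≢y πx≡πy u v πu πv fu fv
    with factor-split (3 + d + (k ∸ 1)) shape u x fu | factor-split (3 + d + (k ∸ 1)) shape v y fv
    where
    shape = ⌊ξpow0⌋-ladder (3 + d) (s≤s t≤)
  ... | i , occU , occX | j , occV , occY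
    with distinct-followers-π (ladder-follower (3 + d) occX) (ladder-follower (3 + d) occY)
           (λ eq → x≢y (⌊⌋-injective eq)) (trans (sym (πL≡πℕ x)) (trans πx≡πy (πL≡πℕ y)))
  ... | inj₁ x₀ = inj₁ (π-constant⇒length≤ u πu occU (before-ladder (3 + d) (s≤s t≤) occX′))
    where
    occX′ = subst (λ z → Occurs (ladder (3 + d) ++ z ∷ []) (length u + i)) x₀ occX
  ... | inj₂ y₀ = inj₂ (π-constant⇒length≤ v πv occV (before-ladder (3 + d) (s≤s t≤) occY′))
    where
    occY′ = subst (λ z → Occurs (ladder (3 + d) ++ z ∷ []) (length v + j)) y₀ occY

  long-exponent : ∀ {ℓ} → k + 2 ≤ ℓ → ℓ ≤ 2 * k ∸ 2 →
                  ∃ λ d → ℓ ≡ 3 + d + (k ∸ 1) × 3 + d ≤ k ∸ 1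
  long-exponent k+2≤ℓ ℓ≤ with m≤n⇒∃[o]m+o≡n k+2≤ℓ
  ... | d , refl = d , shape n d , +-cancelʳ-≤ (k ∸ 1) (3 + d) (k ∸ 1) (subst₂ _≤_ (shape n d) (double n) ℓ≤)
    where
    shape : ∀ n d → 4 + n + 2 + d ≡ 3 + d + (3 + n)
    shape = solve-∀
    twice : ∀ n → 2 * (4 + n) ≡ 2 + (3 + n + (3 + n))
    twice = solve-∀
    double : ∀ n → 2 * (4 + n) ∸ 2 ≡ 3 + n + (3 + n)
    double n = cong (_∸ 2) (twice n)

  left-context-short : ∀ ℓ → (2 ≤ ℓ × ℓ ≤ k ∸ 2) ⊎ (k + 2 ≤ ℓ × ℓ ≤ 2 * k ∸ 2) →
                       ∀ {x y} → x ≢ y → πL x ≡ πL y →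
                       ∀ u v {b} → All (_≡ b) (π u) → All (_≡ b) (π v) →
                       IsFactor k (u ++ W ℓ ++ x ∷ []) → IsFactor k (v ++ W ℓ ++ y ∷ []) →
                       length u ≤ k ∸ 3 ⊎ length v ≤ k ∸ 3
  left-context-short _ (inj₁ (s≤s (s≤s {n = d} z≤n) , ℓ≤)) x≢y _ u v πu πv fu fv =
    Sum.map (λ le → ≤-trans le (≤-pred ℓ≤)) (λ le → ≤-trans le (≤-pred ℓ≤))
      (left-context-block d ℓ≤ x≢y u v πu πv fu fv)
  left-context-short ℓ (inj₂ (k+2≤ℓ , ℓ≤)) x≢y πx≡πy u v πu πv fu fv with long-exponent k+2≤ℓ ℓ≤
  ... | d , refl , t≤ =
    Sum.map (λ le → ≤-trans le (≤-pred (≤-pred t≤))) (λ le → ≤-trans le (≤-pred (≤-pred t≤)))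
      (left-context-ladder d t≤ x≢y πx≡πy u v πu πv fu fv)

-- The hypotheses x, y ∈ Rext(w) are implied by the factor hypotheses.
lemma5 : (k : ℕ) .{{_ : NonZero k}} → 4 ≤ k →
    (ℓ : ℕ) → (2 ≤ ℓ × ℓ ≤ k ∸ 2) ⊎ (k + 2 ≤ ℓ × ℓ ≤ 2 * k ∸ 2) →
    (x y : Letter k) → Rext k (ξpow0 k ℓ) x → Rext k (ξpow0 k ℓ) y →
    ¬ (x ≡ y) → πL x ≡ πL y →
    (u v : List (Letter k)) →
    IsFactor k (u ++ ξpow0 k ℓ ++ x ∷ []) → IsFactor k (v ++ ξpow0 k ℓ ++ y ∷ []) →
    π u ≡ π v →
    (IsPrefix (π u) (replicate (k ∸ 1) true) ⊎ IsPrefix (π u) (replicate (k ∸ 1) false)) →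
    length u ≡ length v × length u ≤ k ∸ 3
lemma5 _ (s≤s (s≤s (s≤s (s≤s {n = n} _)))) ℓ range x y _ _ x≢y πx≡πy u v fu fv πu≡πv prefix
  with Sum.[ (λ p → true , IsPrefix-replicate p) , (λ p → false , IsPrefix-replicate p) ]′ prefix
... | b , πu≡b = |u|≡|v| , Sum.[ id , (λ |v|≤ → subst (_≤ _) (sym |u|≡|v|) |v|≤) ]′
                   (left-context-short ℓ range x≢y πx≡πy u v πu≡b (subst (All (_≡ b)) πu≡πv πu≡b) fu fv)
  where
  open Structure n
  |u|≡|v| : length u ≡ length v
  |u|≡|v| = trans (sym (length-map πL u)) (trans (cong length πu≡πv) (length-map πL v))
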